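{- Let $G=(V,E)$ be a finite, unweighted, undirected graph with $n$ vertices, let $\sigma$ be a positive integer and $\Delta=4\sigma$. Choose a permutation $\pi$ of $V$ uniformly at random and, independently, an integer $R$ uniformly at random from $\{\Delta/4,\Delta/4+1,\ldots,\Delta/2\}$, and let $\mathcal{P}$ be the partition of $V$ constructed from $(\pi,R)$ as described in the context. Then for every vertex $x\in V$, $$\Pr\bigl[x \text{ is a guard of } \mathcal{P}\bigr]\le \frac{4}{\Delta}\ln\frac{|B(x,\Delta/2)|}{|B(x,\Delta/4-1)|}.$$
   Context: $d(u,v)$ denotes the shortest-path distance in $G$ (number of edges; $\infty$ if no path). For $v\in V$ and integer $R$, $B(v,R)=\{x\in V: d(v,x)\le R\}$. Construction: given a permutation $\pi$ of $V$ and an integer $R$, each vertex $x$ is assigned to the cluster $C_y$ where $y$ is the vertex with smallest $\pi(y)$ among all $z\in V$ with $x\in B(z,R)$; i.e. $C_y=\{x\in V: x\in B(y,R)\text{ and }\pi(y)\le\pi(z)\text{ for all } z\in V \text{ with } x\in B(z,R)\}$. The partition is $\mathcal{P}=\{C_y\}_{y\in V}$. A vertex $u$ is a guard of $\mathcal{P}$ if $u\in C_y$ and $d(y,u)=R$. -}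

module Defs where

open import Data.Nat as ℕ using (ℕ; zero; suc; _+_; _!)
open import Data.Integer using (+_)
open import Data.Rational as ℚ using (ℚ; 0ℚ; 1ℚ; _/_)
open import Data.Fin using (Fin; toℕ) renaming (_≤_ to _≤ᶠ_; _≤?_ to _≤ᶠ?_)
open import Data.Fin.Properties using (any?; all?) renaming (_≟_ to _≟ᶠ_)
open import Data.Vec using (Vec; []; _∷_; lookup)
open import Data.List using (List; []; _∷_; map; concatMap; filter; length; allFin; upTo; cartesianProduct)
open import Data.Product using (Σ; _×_; _,_; proj₁; proj₂)
open import Relation.Nullary using (¬_; Dec; yes; no)
open import Relation.Nullary.Decidable using (_×-dec_; _→-dec_; ¬?)
open import Relation.Binary using (Decidable)
open import Relation.Binary.PropositionalEquality using (_≡_)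

record Graph (n : ℕ) : Set₁ where
  field
    Adj    : Fin n → Fin n → Set
    adj?   : Decidable Adj
    sym    : ∀ {u v} → Adj u v → Adj v u
    irrefl : ∀ {u} → ¬ Adj u u

module _ {n : ℕ} (G : Graph n) where
  open Graph G

  data Walk : ℕ → Fin n → Fin n → Set where
    here : ∀ {u} → Walk 0 u u
    step : ∀ {k u w v} → Adj u w → Walk k w v → Walk (suc k) u v

  walk? : ∀ k u v → Dec (Walk k u v)
  walk? zero u v with u ≟ᶠ v
  ... | yes _≡_.refl = yes here
  ... | no u≢v = no λ { here → u≢v _≡_.refl }
  walk? (suc k) u v with any? (λ w → adj? u w ×-dec walk? k w v)
  ... | yes (w , a , p) = yes (step a p)
  ... | no ¬w = no λ { (step a p) → ¬w (_ , a , p) }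

  DistLt : Fin n → Fin n → ℕ → Set
  DistLt u v r = Σ (Fin r) λ k → Walk (toℕ k) u v

  DistLe : Fin n → Fin n → ℕ → Set
  DistLe u v r = DistLt u v (suc r)

  DistEq : Fin n → Fin n → ℕ → Set
  DistEq u v r = DistLe u v r × ¬ DistLt u v r

  distLt? : ∀ u v r → Dec (DistLt u v r)
  distLt? u v r = any? (λ k → walk? (toℕ k) u v)

  InBall : Fin n → ℕ → Fin n → Set
  InBall v r x = DistLe v x r

  ballSize : Fin n → ℕ → ℕ
  ballSize v r = length (filter (λ x → distLt? v x (suc r)) (allFin n))

  -- |{x : d(v,x) < r}| = |B(v, r - 1)| (for r ≥ 1)
  ballLtSize : Fin n → ℕ → ℕ
  ballLtSize v r = length (filter (λ x → distLt? v x r) (allFin n))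

  -- A permutation π of V is represented by the vector (π(0),…,π(n-1))
  -- of its values; it is a permutation iff injective.
  IsPerm : Vec (Fin n) n → Set
  IsPerm π = ∀ i j → lookup π i ≡ lookup π j → i ≡ j

  isPerm? : ∀ π → Dec (IsPerm π)
  isPerm? π = all? λ i → all? λ j → (lookup π i ≟ᶠ lookup π j) →-dec (i ≟ᶠ j)

  InCluster : Vec (Fin n) n → ℕ → Fin n → Fin n → Set
  InCluster π R y x =
    InBall y R x × (∀ z → InBall z R x → lookup π y ≤ᶠ lookup π z)

  inCluster? : ∀ π R y x → Dec (InCluster π R y x)
  inCluster? π R y x =
    distLt? y x (suc R) ×-dec
    all? (λ z → distLt? z x (suc R) →-dec (lookup π y ≤ᶠ? lookup π z))

  IsGuard : Vec (Fin n) n → ℕ → Fin n → Set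
  IsGuard π R x = Σ (Fin n) λ y → InCluster π R y x × DistEq y x R

  isGuard? : ∀ π R x → Dec (IsGuard π R x)
  isGuard? π R x = any? λ y →
    inCluster? π R y x ×-dec (distLt? y x (suc R) ×-dec ¬? (distLt? y x R))

allVecs : (n m : ℕ) → List (Vec (Fin n) m)
allVecs n zero    = [] ∷ []
allVecs n (suc m) = concatMap (λ i → map (i ∷_) (allVecs n m)) (allFin n)

-- a / b as a rational (b = 0 gives 0; only used with b > 0)
frac : ℕ → ℕ → ℚ
frac a zero    = 0ℚ
frac a (suc b) = (+ a) / suc b

-- Pr[x is a guard], for π uniform over permutations of V and
-- R uniform on {σ, σ+1, …, 2σ} = {Δ/4, …, Δ/2} (Δ = 4σ), independently.
guardProb : ∀ {n} → Graph n → (σ : ℕ) → Fin n → ℚ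
guardProb {n} G σ x =
  frac (length (filter good? space)) (length perms ℕ.* suc σ)
  where
  perms : List (Vec (Fin n) n)
  perms = filter (isPerm? G) (allVecs n n)
  radii : List ℕ
  radii = map (λ i → σ + i) (upTo (suc σ))
  space = cartesianProduct perms radii
  good? : (p : Vec (Fin n) n × ℕ) → Dec (IsGuard G (proj₁ p) (proj₂ p) x)
  good? (π , R) = isGuard? G π R x

_^ℚ_ : ℚ → ℕ → ℚ
q ^ℚ zero  = 1ℚ
q ^ℚ suc k = q ℚ.* (q ^ℚ k)

expPartial : ℚ → ℕ → ℚ
expPartial t zero    = 1ℚ
expPartial t (suc N) = expPartial t N ℚ.+ (t ^ℚ suc N) ℚ.* frac 1 (suc N !)

-- t ≤ ln y  (for t ≥ 0):  exp t = Σ_k t^k/k! ≤ y, i.e. every partial sum ≤ y.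
_≤ln_ : ℚ → ℚ → Set
t ≤ln y = ∀ N → expPartial t N ℚ.≤ y

{-# OPTIONS --safe #-}
-- Fix x, let b(r) be the number of vertices at distance < r from x, and let p(R) be the fraction
-- of permutations π for which x is a guard of the partition built from (π, R).
-- Exchanging the π-values of y and y′ maps the permutations with x ∈ C_y injectively to those
-- with x ∈ C_y′ whenever d(y′, x) ≤ R.  Hence x ∈ C_y for no more permutations than x ∈ C_x, and
-- as x lies in at most one cluster, x ∈ C_x for at most a 1/b(R+1) fraction of them.  A guard
-- lies in the cluster of a vertex at distance exactly R, so p(R) · b(R+1) ≤ b(R+1) − b(R), i.e.
-- b(R) ≤ (1 − p(R)) · b(R+1) ≤ e^{−p(R)} · b(R+1).  Telescoping over R = σ, …, 2σ gives
-- e^{Σ p(R)} ≤ b(2σ+1) / b(σ), and σ · Pr[guard] = σ/(σ+1) · Σ p(R) ≤ Σ p(R).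
-- Since ≤ln speaks about the partial sums E_N of the exponential series, 1 − u ≤ e^{−u} is used
-- in the form (1 − u) · E_N(t + u) ≤ E_N(t), which follows from E_N(t + u) − E_N(t) ≤ u · E_N(t + u).
module Submission where

open import Defs
open import Data.Bool using (true; false)
open import Data.Empty using (⊥-elim)
open import Data.Fin as Fin using (Fin; inject₁) renaming (_≤_ to _≤ᶠ_)
import Data.Fin.Properties as Fin
open import Data.Fin.Permutation.Components using (transpose; transpose-inverse)
open import Data.List as List
  using (List; []; _∷_; _++_; map; filter; length; cartesianProduct; allFin; applyUpTo; upTo)
import Data.List.Properties as List
open import Data.List.Membership.Propositional using (_∈_)
open import Data.List.Membership.Propositional.Properties
open import Data.List.Relation.Unary.Any using (here; there)
import Data.List.Relation.Unary.All as All
open import Data.List.Relation.Unary.AllPairs using ([]; _∷_)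
open import Data.List.Relation.Unary.Unique.Propositional using (Unique)
import Data.List.Relation.Unary.Unique.Propositional.Properties as Unique
open import Data.Nat as ℕ using (ℕ; zero; suc; z≤n; s≤s; _!)
import Data.Nat.DivMod as ℕ
open import Data.Nat.ListAction using (sum)
import Data.Nat.ListAction.Properties as ℕ
import Data.Nat.Properties as ℕ
import Data.Nat.Solver as ℕ-Solver
open import Data.Product using (_×_; _,_; proj₁; proj₂)
open import Data.Rational using () renaming (_*_ to _*ℚ_; _≤_ to _≤ℚ_)
import Data.Rational.Properties as ℚ
import Data.Rational.Solver as ℚ-Solver
open import Data.Sum using (inj₁; inj₂)
open import Data.Vec as Vec using (Vec; lookup; tabulate)
import Data.Vec.Properties as Vec
open import Function using (_∘_)
open import Relation.Binary.PropositionalEquality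
open import Relation.Nullary using (¬_; Dec; yes; no; _because_; _×-dec_; ¬?)
open import Relation.Unary using (Decidable)

open import Algebra.Properties.CommutativeSemigroup ℕ.+-commutativeSemigroup using (interchange)

module _ where
  open import Data.Integer as ℤ using (+_)
  import Data.Integer.Properties as ℤ
  open import Data.Rational using (ℚ; 0ℚ; 1ℚ; _+_; _*_; _-_; -_; _≤_; toℚᵘ; nonNegative)
  open import Data.Rational.Unnormalised as ℚᵘ using (mkℚᵘ; *≤*)
  import Data.Rational.Unnormalised.Properties as ℚᵘ

  -- Rational arithmetic

  *-monoˡ-≤-nonNeg : ∀ {p q} r → 0ℚ ≤ r → p ≤ q → r * p ≤ r * q
  *-monoˡ-≤-nonNeg r 0≤r = ℚ.*-monoˡ-≤-nonNeg r {{nonNegative 0≤r}}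

  *-monoʳ-≤-nonNeg : ∀ {p q} r → 0ℚ ≤ r → p ≤ q → p * r ≤ q * r
  *-monoʳ-≤-nonNeg r 0≤r = ℚ.*-monoʳ-≤-nonNeg r {{nonNegative 0≤r}}

  *-nonNeg : ∀ {p q} → 0ℚ ≤ p → 0ℚ ≤ q → 0ℚ ≤ p * q
  *-nonNeg {p} {q} 0≤p 0≤q = ℚ.≤-trans (ℚ.≤-reflexive (sym (ℚ.*-zeroˡ q))) (*-monoʳ-≤-nonNeg q 0≤q 0≤p)

  p≤q⇒0≤q-p : ∀ {p q} → p ≤ q → 0ℚ ≤ q - p
  p≤q⇒0≤q-p {p} {q} p≤q = begin
    0ℚ     ≡⟨ ℚ.+-inverseʳ p ⟨
    p - p  ≤⟨ ℚ.+-monoˡ-≤ (- p) p≤q ⟩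
    q - p  ∎
    where open ℚ.≤-Reasoning

  p≤p+q : ∀ p {q} → 0ℚ ≤ q → p ≤ p + q
  p≤p+q p {q} 0≤q = ℚ.≤-trans (ℚ.≤-reflexive (sym (ℚ.+-identityʳ p))) (ℚ.+-monoʳ-≤ p 0≤q)

  fromℕ : ℕ → ℚ
  fromℕ n = frac n 1

  toℚᵘ-frac : ∀ a b → toℚᵘ (frac a (suc b)) ℚᵘ.≃ mkℚᵘ (+ a) b
  toℚᵘ-frac a b = ℚ.toℚᵘ-fromℚᵘ (mkℚᵘ (+ a) b)

  frac-cross-≤ : ∀ a b c d → a ℕ.* suc d ℕ.≤ c ℕ.* suc b → frac a (suc b) ≤ frac c (suc d)
  frac-cross-≤ a b c d ad≤cb = ℚ.toℚᵘ-cancel-≤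
    (ℚᵘ.≤-respʳ-≃ (ℚᵘ.≃-sym (toℚᵘ-frac c d)) (ℚᵘ.≤-respˡ-≃ (ℚᵘ.≃-sym (toℚᵘ-frac a b))
      (*≤* (subst₂ ℤ._≤_ (ℤ.pos-* a (suc d)) (ℤ.pos-* c (suc b)) (ℤ.+≤+ ad≤cb)))))

  frac-cross-≡ : ∀ a b c d → a ℕ.* suc d ≡ c ℕ.* suc b → frac a (suc b) ≡ frac c (suc d)
  frac-cross-≡ a b c d ad≡cb = ℚ.≤-antisym (frac-cross-≤ a b c d (ℕ.≤-reflexive ad≡cb))
                                           (frac-cross-≤ c d a b (ℕ.≤-reflexive (sym ad≡cb)))

  frac-* : ∀ a b c d → frac a (suc b) * frac c (suc d) ≡ frac (a ℕ.* c) (suc b ℕ.* suc d)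
  frac-* a b c d = ℚ.toℚᵘ-injective (begin
    toℚᵘ (frac a (suc b) * frac c (suc d))
      ≈⟨ ℚ.toℚᵘ-homo-* (frac a (suc b)) (frac c (suc d)) ⟩
    toℚᵘ (frac a (suc b)) ℚᵘ.* toℚᵘ (frac c (suc d))
      ≈⟨ ℚᵘ.*-cong (toℚᵘ-frac a b) (toℚᵘ-frac c d) ⟩
    mkℚᵘ (+ a ℤ.* + c) (d ℕ.+ b ℕ.* suc d)
      ≡⟨ cong (λ z → mkℚᵘ z _) (ℤ.pos-* a c) ⟨
    mkℚᵘ (+ (a ℕ.* c)) (d ℕ.+ b ℕ.* suc d)
      ≈⟨ toℚᵘ-frac (a ℕ.* c) _ ⟨
    toℚᵘ (frac (a ℕ.* c) (suc b ℕ.* suc d)) ∎)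
    where open ℚᵘ.≃-Reasoning

  frac-+ : ∀ a b c d →
           frac a (suc b) + frac c (suc d) ≡ frac (a ℕ.* suc d ℕ.+ c ℕ.* suc b) (suc b ℕ.* suc d)
  frac-+ a b c d = ℚ.toℚᵘ-injective (begin
    toℚᵘ (frac a (suc b) + frac c (suc d))
      ≈⟨ ℚ.toℚᵘ-homo-+ (frac a (suc b)) (frac c (suc d)) ⟩
    toℚᵘ (frac a (suc b)) ℚᵘ.+ toℚᵘ (frac c (suc d))
      ≈⟨ ℚᵘ.+-cong (toℚᵘ-frac a b) (toℚᵘ-frac c d) ⟩
    mkℚᵘ (+ a ℤ.* + suc d ℤ.+ + c ℤ.* + suc b) (d ℕ.+ b ℕ.* suc d)
      ≡⟨ cong (λ z → mkℚᵘ z _) numerator ⟨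
    mkℚᵘ (+ (a ℕ.* suc d ℕ.+ c ℕ.* suc b)) (d ℕ.+ b ℕ.* suc d)
      ≈⟨ toℚᵘ-frac _ _ ⟨
    toℚᵘ (frac (a ℕ.* suc d ℕ.+ c ℕ.* suc b) (suc b ℕ.* suc d)) ∎)
    where
    open ℚᵘ.≃-Reasoning
    numerator : + (a ℕ.* suc d ℕ.+ c ℕ.* suc b) ≡ + a ℤ.* + suc d ℤ.+ + c ℤ.* + suc b
    numerator = trans (ℤ.pos-+ (a ℕ.* suc d) (c ℕ.* suc b))
                      (cong₂ ℤ._+_ (ℤ.pos-* a (suc d)) (ℤ.pos-* c (suc b)))

  frac-zero : ∀ m → frac 0 m ≡ 0ℚ
  frac-zero zero    = refl
  frac-zero (suc m) = ℚ.0/n≡0 (suc m)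

  frac-nonNeg : ∀ a m → 0ℚ ≤ frac a m
  frac-nonNeg a zero    = ℚ.≤-refl
  frac-nonNeg a (suc m) = ℚ.nonNegative⁻¹ _ {{ℚ.normalize-nonNeg a (suc m)}}

  fromℕ-suc : ∀ n → fromℕ (suc n) ≡ 1ℚ + fromℕ n
  fromℕ-suc n = sym (trans (frac-+ 1 0 n 0) (frac-cross-≡ (1 ℕ.* 1 ℕ.+ n ℕ.* 1) 0 (suc n) 0
    (solve 1 (λ n → (con 1 :* con 1 :+ n :* con 1) :* con 1 := (con 1 :+ n) :* con 1) refl n)))
    where open ℕ-Solver.+-*-Solver

  fromℕ-mono-≤ : ∀ {a b} → a ℕ.≤ b → fromℕ a ≤ fromℕ b
  fromℕ-mono-≤ {a} {b} a≤b = frac-cross-≤ a 0 b 0 (ℕ.*-monoˡ-≤ 1 a≤b)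

  frac-distrib-+ : ∀ a b m → frac (a ℕ.+ b) m ≡ frac a m + frac b m
  frac-distrib-+ a b zero    = refl
  frac-distrib-+ a b (suc m) = sym (trans (frac-+ a m b m)
    (frac-cross-≡ (a ℕ.* suc m ℕ.+ b ℕ.* suc m) (m ℕ.+ m ℕ.* suc m) (a ℕ.+ b) m
      (solve 3 (λ a b m → (a :* (con 1 :+ m) :+ b :* (con 1 :+ m)) :* (con 1 :+ m)
                       := (a :+ b) :* (con 1 :+ (m :+ m :* (con 1 :+ m)))) refl a b m)))
    where open ℕ-Solver.+-*-Solver

  frac-*-fromℕ : ∀ a m b → frac a m * fromℕ b ≡ frac (a ℕ.* b) m
  frac-*-fromℕ a zero    b = ℚ.*-zeroˡ (fromℕ b)
  frac-*-fromℕ a (suc m) b = trans (frac-* a m b 0)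
    (frac-cross-≡ (a ℕ.* b) (m ℕ.* 1) (a ℕ.* b) m (cong (λ k → a ℕ.* b ℕ.* suc k) (sym (ℕ.*-identityʳ m))))

  frac-numer-cancel : ∀ n a → frac (suc n ℕ.* a) (suc n) ≡ fromℕ a
  frac-numer-cancel n a = frac-cross-≡ (suc n ℕ.* a) n a 0
    (trans (ℕ.*-identityʳ (suc n ℕ.* a)) (ℕ.*-comm (suc n) a))

  frac-denom-cancel : ∀ a m n → frac a (m ℕ.* suc n) * fromℕ (suc n) ≡ frac a m
  frac-denom-cancel a zero    n = ℚ.*-zeroˡ (fromℕ (suc n))
  frac-denom-cancel a (suc m) n = trans (frac-*-fromℕ a (suc m ℕ.* suc n) (suc n))
    (frac-cross-≡ (a ℕ.* suc n) (n ℕ.+ m ℕ.* suc n) a m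
      (solve 3 (λ a m n → a :* (con 1 :+ n) :* (con 1 :+ m) := a :* (con 1 :+ (n :+ m :* (con 1 :+ n))))
             refl a m n))
    where open ℕ-Solver.+-*-Solver

  ≤-frac : ∀ {q} a b → 0 ℕ.< b → q * fromℕ b ≤ fromℕ a → q ≤ frac a b
  ≤-frac {q} a (suc b) _ qb≤a = ℚ.*-cancelʳ-≤-pos (fromℕ (suc b)) {{ℚ.normalize-pos (suc b) 1}} (begin
    q * fromℕ (suc b)                ≤⟨ qb≤a ⟩
    fromℕ a                          ≡⟨ frac-numer-cancel b a ⟨
    frac (suc b ℕ.* a) (suc b)       ≡⟨ cong (λ z → frac z (suc b)) (ℕ.*-comm (suc b) a) ⟩
    frac (a ℕ.* suc b) (suc b)       ≡⟨ frac-*-fromℕ a (suc b) (suc b) ⟨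
    frac a (suc b) * fromℕ (suc b)   ∎)
    where open ℚ.≤-Reasoning

  fromℕ*frac-≤ : ∀ c m s → fromℕ s * frac c (m ℕ.* suc s) ≤ frac c m
  fromℕ*frac-≤ c m s = begin
    fromℕ s * q        ≤⟨ *-monoʳ-≤-nonNeg q (frac-nonNeg c (m ℕ.* suc s)) (fromℕ-mono-≤ (ℕ.n≤1+n s)) ⟩
    fromℕ (suc s) * q  ≡⟨ ℚ.*-comm (fromℕ (suc s)) q ⟩
    q * fromℕ (suc s)  ≡⟨ frac-denom-cancel c m s ⟩
    frac c m           ∎
    where
    open ℚ.≤-Reasoning
    q = frac c (m ℕ.* suc s)

  fromℕ-≤-[1-frac]* : ∀ {k a b m} → 0 ℕ.< m → k ℕ.* b ℕ.+ m ℕ.* a ℕ.≤ m ℕ.* b →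
                      fromℕ a ≤ (1ℚ - frac k m) * fromℕ b
  fromℕ-≤-[1-frac]* {k} {a} {b} {m@(suc m-1)} _ kb+ma≤mb = begin
    fromℕ a
      ≡⟨ solve 2 (λ a v → a := v :+ a :- v) refl (fromℕ a) (u * fromℕ b) ⟩
    u * fromℕ b + fromℕ a - u * fromℕ b
      ≤⟨ ℚ.+-monoˡ-≤ (- (u * fromℕ b)) ub+a≤b ⟩
    fromℕ b - u * fromℕ b
      ≡⟨ solve 2 (λ b u → b :- u :* b := (con 1ℚ :- u) :* b) refl (fromℕ b) u ⟩
    (1ℚ - u) * fromℕ b ∎
    where
    open ℚ.≤-Reasoning
    open ℚ-Solver.+-*-Solver
    u = frac k m
    ub+a≤b : u * fromℕ b + fromℕ a ≤ fromℕ b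
    ub+a≤b = begin
      u * fromℕ b + fromℕ a
        ≡⟨ cong₂ _+_ (frac-*-fromℕ k m b) (sym (frac-numer-cancel m-1 a)) ⟩
      frac (k ℕ.* b) m + frac (m ℕ.* a) m
        ≡⟨ frac-distrib-+ (k ℕ.* b) (m ℕ.* a) m ⟨
      frac (k ℕ.* b ℕ.+ m ℕ.* a) m
        ≤⟨ frac-cross-≤ (k ℕ.* b ℕ.+ m ℕ.* a) m-1 (m ℕ.* b) m-1 (ℕ.*-monoˡ-≤ m kb+ma≤mb) ⟩
      frac (m ℕ.* b) m
        ≡⟨ frac-numer-cancel m-1 b ⟩
      fromℕ b ∎

  -- Partial sums of the exponential series

  pow-nonNeg : ∀ k {t} → 0ℚ ≤ t → 0ℚ ≤ t ^ℚ k
  pow-nonNeg zero    0≤t = ℚ.nonNegative⁻¹ 1ℚ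
  pow-nonNeg (suc k) 0≤t = *-nonNeg 0≤t (pow-nonNeg k 0≤t)

  pow-mono-≤ : ∀ k {a b} → 0ℚ ≤ b → b ≤ a → b ^ℚ k ≤ a ^ℚ k
  pow-mono-≤ zero    0≤b b≤a = ℚ.≤-refl
  pow-mono-≤ (suc k) {a} {b} 0≤b b≤a = ℚ.≤-trans
    (*-monoʳ-≤-nonNeg (b ^ℚ k) (pow-nonNeg k 0≤b) b≤a)
    (*-monoˡ-≤-nonNeg a (ℚ.≤-trans 0≤b b≤a) (pow-mono-≤ k 0≤b b≤a))

  pow-suc-≤-mean-value : ∀ k {a b} → 0ℚ ≤ b → b ≤ a →
                         a ^ℚ suc k ≤ b ^ℚ suc k + (a - b) * fromℕ (suc k) * a ^ℚ k
  pow-suc-≤-mean-value zero {a} {b} _ _ = ℚ.≤-reflexive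
    (solve 2 (λ a b → a :* con 1ℚ := b :* con 1ℚ :+ (a :- b) :* con 1ℚ :* con 1ℚ) refl a b)
    where open ℚ-Solver.+-*-Solver
  pow-suc-≤-mean-value (suc k) {a} {b} 0≤b b≤a = begin
    a * a ^ℚ suc k
      ≤⟨ *-monoˡ-≤-nonNeg a (ℚ.≤-trans 0≤b b≤a) (pow-suc-≤-mean-value k 0≤b b≤a) ⟩
    a * (b ^ℚ suc k + (a - b) * fromℕ (suc k) * a ^ℚ k)
      ≡⟨ solve 5 (λ a b bᵏ k aᵏ → a :* (bᵏ :+ (a :- b) :* k :* aᵏ)
                               := b :* bᵏ :+ (a :- b) :* bᵏ :+ (a :- b) :* k :* (a :* aᵏ))
               refl a b (b ^ℚ suc k) (fromℕ (suc k)) (a ^ℚ k) ⟩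
    b ^ℚ suc (suc k) + (a - b) * b ^ℚ suc k + (a - b) * fromℕ (suc k) * a ^ℚ suc k
      ≤⟨ ℚ.+-monoˡ-≤ ((a - b) * fromℕ (suc k) * a ^ℚ suc k) (ℚ.+-monoʳ-≤ (b ^ℚ suc (suc k))
           (*-monoˡ-≤-nonNeg (a - b) (p≤q⇒0≤q-p b≤a) (pow-mono-≤ (suc k) 0≤b b≤a))) ⟩
    b ^ℚ suc (suc k) + (a - b) * a ^ℚ suc k + (a - b) * fromℕ (suc k) * a ^ℚ suc k
      ≡⟨ solve 4 (λ bᵏ h aᵏ k → bᵏ :+ h :* aᵏ :+ h :* k :* aᵏ := bᵏ :+ h :* (con 1ℚ :+ k) :* aᵏ)
               refl (b ^ℚ suc (suc k)) (a - b) (a ^ℚ suc k) (fromℕ (suc k)) ⟩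
    b ^ℚ suc (suc k) + (a - b) * (1ℚ + fromℕ (suc k)) * a ^ℚ suc k
      ≡⟨ cong (λ z → b ^ℚ suc (suc k) + (a - b) * z * a ^ℚ suc k) (fromℕ-suc (suc k)) ⟨
    b ^ℚ suc (suc k) + (a - b) * fromℕ (suc (suc k)) * a ^ℚ suc k ∎
    where
    open ℚ.≤-Reasoning
    open ℚ-Solver.+-*-Solver

  frac-1-suc!-* : ∀ k → frac 1 (suc k !) * fromℕ (suc k) ≡ frac 1 (k !)
  frac-1-suc!-* k = trans (cong (λ d → frac 1 d * fromℕ (suc k)) (ℕ.*-comm (suc k) (k !)))
                          (frac-denom-cancel 1 (k !) k)

  expTerm-nonNeg : ∀ k {t} → 0ℚ ≤ t → 0ℚ ≤ t ^ℚ k * frac 1 (k !)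
  expTerm-nonNeg k 0≤t = *-nonNeg (pow-nonNeg k 0≤t) (frac-nonNeg 1 (k !))

  expPartial-zero : ∀ N → expPartial 0ℚ N ≡ 1ℚ
  expPartial-zero zero    = refl
  expPartial-zero (suc N) = begin
    expPartial 0ℚ N + 0ℚ ^ℚ suc N * c
      ≡⟨ cong (_+ 0ℚ ^ℚ suc N * c) (expPartial-zero N) ⟩
    1ℚ + 0ℚ * 0ℚ ^ℚ N * c
      ≡⟨ solve 2 (λ p c → con 1ℚ :+ con 0ℚ :* p :* c := con 1ℚ) refl (0ℚ ^ℚ N) c ⟩
    1ℚ ∎
    where
    open ≡-Reasoning
    open ℚ-Solver.+-*-Solver
    c = frac 1 (suc N !)

  expPartial-nonNeg : ∀ N {t} → 0ℚ ≤ t → 0ℚ ≤ expPartial t N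
  expPartial-nonNeg zero    _   = ℚ.nonNegative⁻¹ 1ℚ
  expPartial-nonNeg (suc N) 0≤t = ℚ.+-mono-≤ (expPartial-nonNeg N 0≤t) (expTerm-nonNeg (suc N) 0≤t)

  expPartial-≤-suc : ∀ N {t} → 0ℚ ≤ t → expPartial t N ≤ expPartial t (suc N)
  expPartial-≤-suc N 0≤t = p≤p+q _ (expTerm-nonNeg (suc N) 0≤t)

  expPartial-mono-≤ : ∀ N {s t} → 0ℚ ≤ s → s ≤ t → expPartial s N ≤ expPartial t N
  expPartial-mono-≤ zero    _   _   = ℚ.≤-refl
  expPartial-mono-≤ (suc N) 0≤s s≤t = ℚ.+-mono-≤ (expPartial-mono-≤ N 0≤s s≤t)
    (*-monoʳ-≤-nonNeg _ (frac-nonNeg 1 (suc N !)) (pow-mono-≤ (suc N) 0≤s s≤t))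

  expPartial-suc-≤-mean-value : ∀ N {a b} → 0ℚ ≤ b → b ≤ a →
    expPartial a (suc N) ≤ expPartial b (suc N) + (a - b) * expPartial a N
  expPartial-suc-≤-mean-value zero {a} {b} _ _ = ℚ.≤-reflexive
    (solve 2 (λ a b → con 1ℚ :+ a :* con 1ℚ :* con 1ℚ
                    := con 1ℚ :+ b :* con 1ℚ :* con 1ℚ :+ (a :- b) :* con 1ℚ) refl a b)
    where open ℚ-Solver.+-*-Solver
  expPartial-suc-≤-mean-value (suc N) {a} {b} 0≤b b≤a = begin
    expPartial a (suc N) + a ^ℚ suc (suc N) * c
      ≤⟨ ℚ.+-mono-≤ (expPartial-suc-≤-mean-value N 0≤b b≤a)
           (*-monoʳ-≤-nonNeg c (frac-nonNeg 1 (suc (suc N) !)) (pow-suc-≤-mean-value (suc N) 0≤b b≤a)) ⟩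
    (expPartial b (suc N) + (a - b) * expPartial a N)
      + (b ^ℚ suc (suc N) + (a - b) * fromℕ (suc (suc N)) * a ^ℚ suc N) * c
      ≡⟨ solve 7 (λ Eb h Ea bᵏ k aᵏ c → (Eb :+ h :* Ea) :+ (bᵏ :+ h :* k :* aᵏ) :* c
                                      := (Eb :+ bᵏ :* c) :+ h :* (Ea :+ aᵏ :* (c :* k)))
               refl (expPartial b (suc N)) (a - b) (expPartial a N) (b ^ℚ suc (suc N))
                    (fromℕ (suc (suc N))) (a ^ℚ suc N) c ⟩
    expPartial b (suc (suc N)) + (a - b) * (expPartial a N + a ^ℚ suc N * (c * fromℕ (suc (suc N))))
      ≡⟨ cong (λ z → expPartial b (suc (suc N)) + (a - b) * (expPartial a N + a ^ℚ suc N * z))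
              (frac-1-suc!-* (suc N)) ⟩
    expPartial b (suc (suc N)) + (a - b) * expPartial a (suc N) ∎
    where
    open ℚ.≤-Reasoning
    open ℚ-Solver.+-*-Solver
    c = frac 1 (suc (suc N) !)

  expPartial-≤-mean-value : ∀ N {a b} → 0ℚ ≤ b → b ≤ a →
    expPartial a N ≤ expPartial b N + (a - b) * expPartial a N
  expPartial-≤-mean-value zero    0≤b b≤a = p≤p+q 1ℚ (*-nonNeg (p≤q⇒0≤q-p b≤a) (ℚ.nonNegative⁻¹ 1ℚ))
  expPartial-≤-mean-value (suc N) {a} {b} 0≤b b≤a = ℚ.≤-trans (expPartial-suc-≤-mean-value N 0≤b b≤a)
    (ℚ.+-monoʳ-≤ (expPartial b (suc N))
      (*-monoˡ-≤-nonNeg (a - b) (p≤q⇒0≤q-p b≤a) (expPartial-≤-suc N (ℚ.≤-trans 0≤b b≤a))))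

  expPartial-shift : ∀ N {t u} → 0ℚ ≤ t → 0ℚ ≤ u → (1ℚ - u) * expPartial (t + u) N ≤ expPartial t N
  expPartial-shift N {t} {u} 0≤t 0≤u = begin
    (1ℚ - u) * E[t+u]
      ≡⟨ solve 2 (λ u E → (con 1ℚ :- u) :* E := E :- u :* E) refl u E[t+u] ⟩
    E[t+u] - u * E[t+u]
      ≤⟨ ℚ.+-monoˡ-≤ (- (u * E[t+u])) mean-value ⟩
    expPartial t N + u * E[t+u] - u * E[t+u]
      ≡⟨ solve 2 (λ E v → E :+ v :- v := E) refl (expPartial t N) (u * E[t+u]) ⟩
    expPartial t N ∎
    where
    open ℚ.≤-Reasoning
    open ℚ-Solver.+-*-Solver
    E[t+u] = expPartial (t + u) N
    mean-value : E[t+u] ≤ expPartial t N + u * E[t+u]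
    mean-value = subst (λ v → E[t+u] ≤ expPartial t N + v * E[t+u])
                       (solve 2 (λ t u → t :+ u :- t := u) refl t u)
                       (expPartial-≤-mean-value N 0≤t (p≤p+q t 0≤u))

  expPartial-step : ∀ N {t u c c′} → 0ℚ ≤ t → 0ℚ ≤ u → 0ℚ ≤ c′ → c ≤ (1ℚ - u) * c′ →
                    expPartial (t + u) N * c ≤ expPartial t N * c′
  expPartial-step N {t} {u} {c} {c′} 0≤t 0≤u 0≤c′ c≤[1-u]c′ = begin
    expPartial (t + u) N * c
      ≤⟨ *-monoˡ-≤-nonNeg _ (expPartial-nonNeg N (ℚ.+-mono-≤ 0≤t 0≤u)) c≤[1-u]c′ ⟩
    expPartial (t + u) N * ((1ℚ - u) * c′)
      ≡⟨ solve 3 (λ E u c → E :* ((con 1ℚ :- u) :* c) := (con 1ℚ :- u) :* E :* c)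
               refl (expPartial (t + u) N) u c′ ⟩
    (1ℚ - u) * expPartial (t + u) N * c′
      ≤⟨ *-monoʳ-≤-nonNeg c′ 0≤c′ (expPartial-shift N 0≤t 0≤u) ⟩
    expPartial t N * c′ ∎
    where
    open ℚ.≤-Reasoning
    open ℚ-Solver.+-*-Solver

  expPartial-telescope : ∀ {m} → 0 ℕ.< m → (a k : ℕ → ℕ) →
    (∀ i → k i ℕ.* a (suc i) ℕ.+ m ℕ.* a i ℕ.≤ m ℕ.* a (suc i)) →
    ∀ r N → expPartial (frac (sum (applyUpTo k r)) m) N * fromℕ (a 0) ≤ fromℕ (a r)
  expPartial-telescope {m} _ a k _ zero N = begin
    expPartial (frac 0 m) N * fromℕ (a 0)  ≡⟨ cong (λ t → expPartial t N * fromℕ (a 0)) (frac-zero m) ⟩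
    expPartial 0ℚ N * fromℕ (a 0)          ≡⟨ cong (_* fromℕ (a 0)) (expPartial-zero N) ⟩
    1ℚ * fromℕ (a 0)                       ≡⟨ ℚ.*-identityˡ (fromℕ (a 0)) ⟩
    fromℕ (a 0)                            ∎
    where open ℚ.≤-Reasoning
  expPartial-telescope {m} 0<m a k bound (suc r) N = begin
    expPartial (frac (k 0 ℕ.+ rest) m) N * fromℕ (a 0)
      ≡⟨ cong (λ t → expPartial t N * fromℕ (a 0)) (trans (frac-distrib-+ (k 0) rest m) (ℚ.+-comm u t)) ⟩
    expPartial (t + u) N * fromℕ (a 0)
      ≤⟨ expPartial-step N (frac-nonNeg rest m) (frac-nonNeg (k 0) m) (frac-nonNeg (a 1) 1)
                           (fromℕ-≤-[1-frac]* 0<m (bound 0)) ⟩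
    expPartial t N * fromℕ (a 1)
      ≤⟨ expPartial-telescope 0<m (a ∘ suc) (k ∘ suc) (bound ∘ suc) r N ⟩
    fromℕ (a (suc r)) ∎
    where
    open ℚ.≤-Reasoning
    rest = sum (applyUpTo (k ∘ suc) r)
    t = frac rest m
    u = frac (k 0) m

open import Data.Nat using (_+_; _*_; _≤_; _<_; _∸_; _/_)

private variable
  A B : Set

-- Counting with finite sums

𝟙 : ∀ {P : Set} → Dec P → ℕ
𝟙 (true  because _) = 1
𝟙 (false because _) = 0

𝟙-yes : ∀ {P : Set} (p? : Dec P) → P → 𝟙 p? ≡ 1
𝟙-yes (yes _) _ = refl
𝟙-yes (no ¬p) p = ⊥-elim (¬p p)

𝟙-≤ : ∀ {P : Set} {m} (p? : Dec P) → (P → 1 ≤ m) → 𝟙 p? ≤ m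
𝟙-≤ (yes p) 1≤m = 1≤m p
𝟙-≤ (no _)  _   = z≤n

𝟙-+-≤ : ∀ {P Q R : Set} (p? : Dec P) (q? : Dec Q) (r? : Dec R) →
        (P → R) → (Q → R) → (P → ¬ Q) → 𝟙 p? + 𝟙 q? ≤ 𝟙 r?
𝟙-+-≤ (yes p) (yes q) r? _   _   P→¬Q = ⊥-elim (P→¬Q p q)
𝟙-+-≤ (yes p) (no _)  r? P→R _   _    = ℕ.≤-reflexive (sym (𝟙-yes r? (P→R p)))
𝟙-+-≤ (no _)  (yes q) r? _   Q→R _    = ℕ.≤-reflexive (sym (𝟙-yes r? (Q→R q)))
𝟙-+-≤ (no _)  (no _)  r? _   _   _    = z≤n

*-𝟙-mono-≤ : ∀ {P : Set} {m n} (p? : Dec P) → (P → m ≤ n) → m * 𝟙 p? ≤ n * 𝟙 p?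
*-𝟙-mono-≤ (yes p) m≤n = ℕ.*-monoˡ-≤ 1 (m≤n p)
*-𝟙-mono-≤ {m = m} {n} (no _) _ = ℕ.≤-reflexive (trans (ℕ.*-zeroʳ m) (sym (ℕ.*-zeroʳ n)))

*-𝟙-≤ : ∀ {P : Set} m (p? : Dec P) → m * 𝟙 p? ≤ m
*-𝟙-≤ m (yes _) = ℕ.≤-reflexive (ℕ.*-identityʳ m)
*-𝟙-≤ m (no _)  = ℕ.≤-trans (ℕ.≤-reflexive (ℕ.*-zeroʳ m)) z≤n

∑ : List A → (A → ℕ) → ℕ
∑ xs f = sum (map f xs)

infix 5 ∑
syntax ∑ xs (λ x → e) = ∑[ x ∈ xs ] e

length-filter≡∑𝟙 : ∀ {P : A → Set} (P? : Decidable P) xs → length (filter P? xs) ≡ ∑[ x ∈ xs ] 𝟙 (P? x)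
length-filter≡∑𝟙 P? []       = refl
length-filter≡∑𝟙 P? (x ∷ xs) with P? x
... | yes _ = cong suc (length-filter≡∑𝟙 P? xs)
... | no  _ = length-filter≡∑𝟙 P? xs

∑-cong : ∀ {f g : A → ℕ} → (∀ x → f x ≡ g x) → ∀ xs → ∑ xs f ≡ ∑ xs g
∑-cong f≗g xs = cong sum (List.map-cong f≗g xs)

∑-mono-≤ : ∀ {f g : A → ℕ} xs → (∀ {x} → x ∈ xs → f x ≤ g x) → ∑ xs f ≤ ∑ xs g
∑-mono-≤ []       _   = z≤n
∑-mono-≤ (x ∷ xs) f≤g = ℕ.+-mono-≤ (f≤g (here refl)) (∑-mono-≤ xs (f≤g ∘ there))

term-≤-∑ : ∀ (f : A → ℕ) {x xs} → x ∈ xs → f x ≤ ∑ xs f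
term-≤-∑ f {xs = y ∷ ys} (here refl)  = ℕ.m≤m+n (f y) (∑ ys f)
term-≤-∑ f {xs = y ∷ ys} (there x∈ys) = ℕ.m≤n⇒m≤o+n (f y) (term-≤-∑ f x∈ys)

∑-0 : ∀ (xs : List A) → ∑[ x ∈ xs ] 0 ≡ 0
∑-0 []       = refl
∑-0 (x ∷ xs) = ∑-0 xs

∑-1 : ∀ (xs : List A) → ∑[ x ∈ xs ] 1 ≡ length xs
∑-1 []       = refl
∑-1 (x ∷ xs) = cong suc (∑-1 xs)

∑-+ : ∀ (f g : A → ℕ) xs → ∑[ x ∈ xs ] f x + g x ≡ ∑ xs f + ∑ xs g
∑-+ f g []       = refl
∑-+ f g (x ∷ xs) = trans (cong (f x + g x +_) (∑-+ f g xs)) (interchange (f x) (g x) (∑ xs f) (∑ xs g))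

∑-*ˡ : ∀ m (f : A → ℕ) xs → ∑[ x ∈ xs ] m * f x ≡ m * ∑ xs f
∑-*ˡ m f []       = sym (ℕ.*-zeroʳ m)
∑-*ˡ m f (x ∷ xs) = trans (cong (m * f x +_) (∑-*ˡ m f xs)) (sym (ℕ.*-distribˡ-+ m (f x) (∑ xs f)))

∑-*ʳ : ∀ m (f : A → ℕ) xs → ∑[ x ∈ xs ] f x * m ≡ ∑ xs f * m
∑-*ʳ m f []       = refl
∑-*ʳ m f (x ∷ xs) = trans (cong (f x * m +_) (∑-*ʳ m f xs)) (sym (ℕ.*-distribʳ-+ m (f x) (∑ xs f)))

∑-swap : ∀ (f : A → B → ℕ) xs ys →
         ∑[ x ∈ xs ] ∑[ y ∈ ys ] f x y ≡ ∑[ y ∈ ys ] ∑[ x ∈ xs ] f x y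
∑-swap f []       ys = sym (∑-0 ys)
∑-swap f (x ∷ xs) ys = trans (cong (∑ ys (f x) +_) (∑-swap f xs ys)) (sym (∑-+ (f x) _ ys))

∑-++ : ∀ (f : A → ℕ) xs ys → ∑ (xs ++ ys) f ≡ ∑ xs f + ∑ ys f
∑-++ f xs ys = trans (cong sum (List.map-++ f xs ys)) (ℕ.sum-++ (map f xs) (map f ys))

∑-map : ∀ (f : B → ℕ) (g : A → B) xs → ∑ (map g xs) f ≡ ∑ xs (f ∘ g)
∑-map f g xs = cong sum (sym (List.map-∘ xs))

∑-cartesianProduct : ∀ (f : A × B → ℕ) xs ys →
                     ∑ (cartesianProduct xs ys) f ≡ ∑[ x ∈ xs ] ∑[ y ∈ ys ] f (x , y)
∑-cartesianProduct f []       ys = refl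
∑-cartesianProduct f (x ∷ xs) ys = begin
  ∑ (map (x ,_) ys ++ cartesianProduct xs ys) f
    ≡⟨ ∑-++ f (map (x ,_) ys) _ ⟩
  ∑ (map (x ,_) ys) f + ∑ (cartesianProduct xs ys) f
    ≡⟨ cong₂ _+_ (∑-map f (x ,_) ys) (∑-cartesianProduct f xs ys) ⟩
  (∑[ y ∈ ys ] f (x , y)) + (∑[ x′ ∈ xs ] ∑[ y ∈ ys ] f (x′ , y)) ∎
  where open ≡-Reasoning

length-filter-cartesianProduct : ∀ {P : A × B → Set} (P? : Decidable P) xs ys →
  length (filter P? (cartesianProduct xs ys)) ≡ ∑[ y ∈ ys ] length (filter (λ x → P? (x , y)) xs)
length-filter-cartesianProduct P? xs ys = begin
  length (filter P? (cartesianProduct xs ys))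
    ≡⟨ length-filter≡∑𝟙 P? (cartesianProduct xs ys) ⟩
  ∑ (cartesianProduct xs ys) (λ p → 𝟙 (P? p))
    ≡⟨ ∑-cartesianProduct (λ p → 𝟙 (P? p)) xs ys ⟩
  ∑[ x ∈ xs ] ∑[ y ∈ ys ] 𝟙 (P? (x , y))
    ≡⟨ ∑-swap (λ x y → 𝟙 (P? (x , y))) xs ys ⟩
  ∑[ y ∈ ys ] ∑[ x ∈ xs ] 𝟙 (P? (x , y))
    ≡⟨ ∑-cong (λ y → length-filter≡∑𝟙 (λ x → P? (x , y)) xs) ys ⟨
  ∑[ y ∈ ys ] length (filter (λ x → P? (x , y)) xs) ∎
  where open ≡-Reasoning

Unique-⊆⇒length-≤ : ∀ {xs ys : List A} → Unique xs → (∀ {x} → x ∈ xs → x ∈ ys) →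
                    length xs ≤ length ys
Unique-⊆⇒length-≤ {xs = []}     _            _       = z≤n
Unique-⊆⇒length-≤ {xs = x ∷ xs} (x∉xs ∷ xs!) x∷xs⊆ys with ∈-∃++ (x∷xs⊆ys (here refl))
... | us , vs , refl = begin
  suc (length xs)          ≤⟨ s≤s (Unique-⊆⇒length-≤ xs! xs⊆us++vs) ⟩
  suc (length (us ++ vs))  ≡⟨ List.length-++-sucʳ us x vs ⟨
  length (us ++ x ∷ vs)    ∎
  where
  open ℕ.≤-Reasoning
  xs⊆us++vs : ∀ {y} → y ∈ xs → y ∈ us ++ vs
  xs⊆us++vs y∈xs with ∈-++⁻ us (x∷xs⊆ys (there y∈xs))
  ... | inj₁ y∈us         = ∈-++⁺ˡ y∈us
  ... | inj₂ (here refl)  = ⊥-elim (All.lookup x∉xs y∈xs refl)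
  ... | inj₂ (there y∈vs) = ∈-++⁺ʳ us y∈vs

Unique-constant⇒length-≤1 : ∀ {xs : List A} → Unique xs → (∀ {x y} → x ∈ xs → y ∈ xs → x ≡ y) →
                            length xs ≤ 1
Unique-constant⇒length-≤1 {xs = []}         _                   _        = z≤n
Unique-constant⇒length-≤1 {xs = x ∷ []}     _                   _        = ℕ.≤-refl
Unique-constant⇒length-≤1 {xs = x ∷ y ∷ xs} ((x≢y All.∷ _) ∷ _) constant =
  ⊥-elim (x≢y (constant (here refl) (there (here refl))))

length-filter-≤-injection : ∀ {P Q : A → Set} (P? : Decidable P) (Q? : Decidable Q) {xs ys} (f : A → A) →
  Unique xs → (∀ {a b} → f a ≡ f b → a ≡ b) → (∀ {a} → a ∈ xs → P a → f a ∈ ys × Q (f a)) →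
  length (filter P? xs) ≤ length (filter Q? ys)
length-filter-≤-injection P? Q? {xs} {ys} f xs! f-injective maps-into = begin
  length (filter P? xs)          ≡⟨ List.length-map f (filter P? xs) ⟨
  length (map f (filter P? xs))  ≤⟨ Unique-⊆⇒length-≤ image! image⊆ ⟩
  length (filter Q? ys)          ∎
  where
  open ℕ.≤-Reasoning
  image! : Unique (map f (filter P? xs))
  image! = Unique.map⁺ f-injective (Unique.filter⁺ P? xs!)
  image⊆ : ∀ {b} → b ∈ map f (filter P? xs) → b ∈ filter Q? ys
  image⊆ b∈image with ∈-map⁻ f b∈image
  ... | a , a∈filter , refl with ∈-filter⁻ P? a∈filter
  ...   | a∈xs , Pa = ∈-filter⁺ Q? (proj₁ (maps-into a∈xs Pa)) (proj₂ (maps-into a∈xs Pa))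

-- Walks, vectors and transpositions

module _ {n} (G : Graph n) where
  open Graph G using (Adj)

  walk-snoc : ∀ {k u w v} → Walk G k u w → Adj w v → Walk G (suc k) u v
  walk-snoc here       w~v = step w~v here
  walk-snoc (step a p) w~v = step a (walk-snoc p w~v)

  walk-reverse : ∀ {k u v} → Walk G k u v → Walk G k v u
  walk-reverse here       = here
  walk-reverse (step a p) = walk-snoc (walk-reverse p) (Graph.sym G a)

  DistLt-sym : ∀ {u v r} → DistLt G u v r → DistLt G v u r
  DistLt-sym (k , p) = k , walk-reverse p

  DistLt-suc : ∀ {u v r} → DistLt G u v r → DistLt G u v (suc r)
  DistLt-suc {u} {v} (k , p) = inject₁ k , subst (λ j → Walk G j u v) (sym (Fin.toℕ-inject₁ k)) p

  ballSize-pos : ∀ x r → 0 < ballSize G x r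
  ballSize-pos x r = begin
    1                                     ≡⟨ 𝟙-yes (inBall? x) (Fin.zero , here) ⟨
    𝟙 (inBall? x)                         ≤⟨ term-≤-∑ (λ y → 𝟙 (inBall? y)) (∈-allFin x) ⟩
    ∑[ y ∈ allFin n ] 𝟙 (inBall? y)       ≡⟨ length-filter≡∑𝟙 inBall? (allFin n) ⟨
    ballSize G x r                        ∎
    where
    open ℕ.≤-Reasoning
    inBall? : ∀ y → Dec (DistLt G x y (suc r))
    inBall? y = distLt? G x y (suc r)

allVecs-suc : ∀ n m → allVecs n (suc m) ≡ List.cartesianProductWith Vec._∷_ (allFin n) (allVecs n m)
allVecs-suc n m = concatMap≡ (allFin n)
  where
  concatMap≡ : ∀ is → List.concatMap (λ i → map (i Vec.∷_) (allVecs n m)) is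
                    ≡ List.cartesianProductWith Vec._∷_ is (allVecs n m)
  concatMap≡ []       = refl
  concatMap≡ (i ∷ is) = cong (map (i Vec.∷_) (allVecs n m) ++_) (concatMap≡ is)

allVecs-unique : ∀ n m → Unique (allVecs n m)
allVecs-unique n zero    = All.[] ∷ []
allVecs-unique n (suc m) rewrite allVecs-suc n m =
  Unique.cartesianProductWith⁺ Vec._∷_ Vec.∷-injective (Unique.allFin⁺ n) (allVecs-unique n m)

∈-allVecs : ∀ {n m} (v : Vec (Fin n) m) → v ∈ allVecs n m
∈-allVecs Vec.[] = here refl
∈-allVecs {n} {suc m} (i Vec.∷ v) rewrite allVecs-suc n m =
  ∈-cartesianProductWith⁺ Vec._∷_ (∈-allFin i) (∈-allVecs v)

module _ {n : ℕ} where

  transpose-injective : ∀ (i j : Fin n) {a b} → transpose i j a ≡ transpose i j b → a ≡ b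
  transpose-injective i j {a} {b} eq = begin
    a                                ≡⟨ transpose-inverse j i ⟨
    transpose j i (transpose i j a)  ≡⟨ cong (transpose j i) eq ⟩
    transpose j i (transpose i j b)  ≡⟨ transpose-inverse j i ⟩
    b                                ∎
    where open ≡-Reasoning

  transpose-preserves : ∀ (Q : Fin n → Set) {i j k} → Q i → Q j → Q k → Q (transpose i j k)
  transpose-preserves Q {i} {j} {k} Qi Qj Qk with k Fin.≟ i
  ... | yes _ = Qj
  ... | no  _ with k Fin.≟ j
  ...   | yes _ = Qi
  ...   | no  _ = Qk

  transpose-ʳ : ∀ (i j : Fin n) → transpose i j j ≡ i
  transpose-ʳ i j with j Fin.≟ i
  ... | yes j≡i = j≡i
  ... | no  _ with j Fin.≟ j
  ...   | yes _   = refl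
  ...   | no  j≢j = ⊥-elim (j≢j refl)

  swapAt : Fin n → Fin n → Vec A n → Vec A n
  swapAt i j π = tabulate (lookup π ∘ transpose i j)

  lookup-swapAt : ∀ i j (π : Vec A n) k → lookup (swapAt i j π) k ≡ lookup π (transpose i j k)
  lookup-swapAt i j π = Vec.lookup∘tabulate (lookup π ∘ transpose i j)

  swapAt-inverse : ∀ i j (π : Vec A n) → swapAt j i (swapAt i j π) ≡ π
  swapAt-inverse i j π = trans
    (Vec.tabulate-cong λ k →
      trans (lookup-swapAt i j π (transpose j i k)) (cong (lookup π) (transpose-inverse i j)))
    (Vec.tabulate∘lookup π)

  swapAt-injective : ∀ i j {π π′ : Vec A n} → swapAt i j π ≡ swapAt i j π′ → π ≡ π′
  swapAt-injective i j {π} {π′} eq = begin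
    π                           ≡⟨ swapAt-inverse i j π ⟨
    swapAt j i (swapAt i j π)   ≡⟨ cong (swapAt j i) eq ⟩
    swapAt j i (swapAt i j π′)  ≡⟨ swapAt-inverse i j π′ ⟩
    π′                          ∎
    where open ≡-Reasoning

-- Permutations and clusters

module _ {n} (G : Graph n) where

  permutations : List (Vec (Fin n) n)
  permutations = filter (isPerm? G) (allVecs n n)

  permutations-unique : Unique permutations
  permutations-unique = Unique.filter⁺ (isPerm? G) (allVecs-unique n n)

  ∈-permutations⁺ : ∀ {π} → IsPerm G π → π ∈ permutations
  ∈-permutations⁺ {π} = ∈-filter⁺ (isPerm? G) (∈-allVecs π)

  ∈-permutations⁻ : ∀ {π} → π ∈ permutations → IsPerm G π
  ∈-permutations⁻ = proj₂ ∘ ∈-filter⁻ (isPerm? G) {xs = allVecs n n}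

  permutations-nonempty : 0 < length permutations
  permutations-nonempty = ∈-length (∈-permutations⁺ {tabulate (λ i → i)} identity-isPerm)
    where
    identity-isPerm : IsPerm G (tabulate (λ i → i))
    identity-isPerm i j eq =
      trans (sym (Vec.lookup∘tabulate (λ k → k) i)) (trans eq (Vec.lookup∘tabulate (λ k → k) j))

  IsPerm-swapAt : ∀ i j π → IsPerm G π → IsPerm G (swapAt i j π)
  IsPerm-swapAt i j π π-injective k l eq = transpose-injective i j
    (π-injective _ _ (trans (sym (lookup-swapAt i j π k)) (trans eq (lookup-swapAt i j π l))))

  InCluster-unique : ∀ {R x y y′} π → IsPerm G π → InCluster G π R y x → InCluster G π R y′ x → y ≡ y′
  InCluster-unique π π-injective (x∈By , y-first) (x∈By′ , y′-first) =
    π-injective _ _ (Fin.≤-antisym (y-first _ x∈By′) (y′-first _ x∈By))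

  InCluster-swapAt : ∀ {R x y y′} π → InBall G y′ R x → InCluster G π R y x →
                     InCluster G (swapAt y y′ π) R y′ x
  InCluster-swapAt {R} {x} {y} {y′} π x∈By′ (x∈By , y-first) = x∈By′ , λ z x∈Bz →
    subst₂ _≤ᶠ_ (sym (trans (lookup-swapAt y y′ π y′) (cong (lookup π) (transpose-ʳ y y′))))
                (sym (lookup-swapAt y y′ π z))
                (y-first _ (transpose-preserves (λ w → InBall G w R x) x∈By x∈By′ x∈Bz))

-- Counting guards

module _ {n} (G : Graph n) (R : ℕ) (x : Fin n) where

  private
    M = length (permutations G)

    inCluster?ₓ : ∀ y π → Dec (InCluster G π R y x)
    inCluster?ₓ y π = inCluster? G π R y x

    onSphere? : ∀ y → Dec (DistEq G y x R)
    onSphere? y = distLt? G y x (suc R) ×-dec ¬? (distLt? G y x R)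

    inBall? : ∀ y → Dec (DistLt G x y (suc R))
    inBall? y = distLt? G x y (suc R)

    inInterior? : ∀ y → Dec (DistLt G x y R)
    inInterior? y = distLt? G x y R

  clusterCount : Fin n → ℕ
  clusterCount y = length (filter (inCluster?ₓ y) (permutations G))

  guardCount : ℕ
  guardCount = length (filter (λ π → isGuard? G π R x) (permutations G))

  sphereSize : ℕ
  sphereSize = ∑[ y ∈ allFin n ] 𝟙 (onSphere? y)

  clusterCount-≤ : ∀ {y y′} → InBall G y′ R x → clusterCount y ≤ clusterCount y′
  clusterCount-≤ {y} {y′} x∈By′ =
    length-filter-≤-injection (inCluster?ₓ y) (inCluster?ₓ y′) (swapAt y y′)
      (permutations-unique G) (swapAt-injective y y′)
      λ {π} π∈perms x∈Cy → ∈-permutations⁺ G (IsPerm-swapAt G y y′ π (∈-permutations⁻ G π∈perms))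
                         , InCluster-swapAt G π x∈By′ x∈Cy

  clusterCount-≤-centre : ∀ y → clusterCount y ≤ clusterCount x
  clusterCount-≤-centre y = clusterCount-≤ (Fin.zero , here)

  ∑-clusterCount-≤ : ∑[ y ∈ allFin n ] clusterCount y ≤ M
  ∑-clusterCount-≤ = begin
    ∑[ y ∈ allFin n ] clusterCount y
      ≡⟨ ∑-cong (λ y → length-filter≡∑𝟙 (inCluster?ₓ y) (permutations G)) (allFin n) ⟩
    ∑[ y ∈ allFin n ] ∑[ π ∈ permutations G ] 𝟙 (inCluster?ₓ y π)
      ≡⟨ ∑-swap (λ y π → 𝟙 (inCluster?ₓ y π)) (allFin n) (permutations G) ⟩
    ∑[ π ∈ permutations G ] ∑[ y ∈ allFin n ] 𝟙 (inCluster?ₓ y π)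
      ≤⟨ ∑-mono-≤ (permutations G) at-most-one-cluster ⟩
    ∑[ π ∈ permutations G ] 1
      ≡⟨ ∑-1 (permutations G) ⟩
    M ∎
    where
    open ℕ.≤-Reasoning
    at-most-one-cluster : ∀ {π} → π ∈ permutations G → ∑[ y ∈ allFin n ] 𝟙 (inCluster?ₓ y π) ≤ 1
    at-most-one-cluster {π} π∈perms = begin
      ∑[ y ∈ allFin n ] 𝟙 (inCluster?ₓ y π)  ≡⟨ length-filter≡∑𝟙 (λ y → inCluster?ₓ y π) (allFin n) ⟨
      length clusters                        ≤⟨ Unique-constant⇒length-≤1 clusters! same-cluster ⟩
      1                                      ∎
      where
      clusters = filter (λ y → inCluster?ₓ y π) (allFin n)
      clusters! : Unique clusters
      clusters! = Unique.filter⁺ (λ y → inCluster?ₓ y π) (Unique.allFin⁺ n)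
      same-cluster : ∀ {y y′} → y ∈ clusters → y′ ∈ clusters → y ≡ y′
      same-cluster y∈ y′∈ = InCluster-unique G π (∈-permutations⁻ G π∈perms) (in-cluster y∈) (in-cluster y′∈)
        where
        in-cluster : ∀ {y} → y ∈ clusters → InCluster G π R y x
        in-cluster = proj₂ ∘ ∈-filter⁻ (λ y → inCluster?ₓ y π) {xs = allFin n}

  clusterCount*ballSize-≤ : clusterCount x * ballSize G x R ≤ M
  clusterCount*ballSize-≤ = begin
    clusterCount x * ballSize G x R
      ≡⟨ cong (clusterCount x *_) (length-filter≡∑𝟙 inBall? (allFin n)) ⟩
    clusterCount x * (∑[ y ∈ allFin n ] 𝟙 (inBall? y))
      ≡⟨ ∑-*ˡ (clusterCount x) (λ y → 𝟙 (inBall? y)) (allFin n) ⟨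
    ∑[ y ∈ allFin n ] clusterCount x * 𝟙 (inBall? y)
      ≤⟨ ∑-mono-≤ (allFin n) (λ {y} _ → *-𝟙-mono-≤ (inBall? y) (clusterCount-≤ ∘ DistLt-sym G)) ⟩
    ∑[ y ∈ allFin n ] clusterCount y * 𝟙 (inBall? y)
      ≤⟨ ∑-mono-≤ (allFin n) (λ {y} _ → *-𝟙-≤ (clusterCount y) (inBall? y)) ⟩
    ∑[ y ∈ allFin n ] clusterCount y
      ≤⟨ ∑-clusterCount-≤ ⟩
    M ∎
    where open ℕ.≤-Reasoning

  guardCount-≤ : guardCount ≤ clusterCount x * sphereSize
  guardCount-≤ = begin
    guardCount
      ≡⟨ length-filter≡∑𝟙 guard? (permutations G) ⟩
    ∑[ π ∈ permutations G ] 𝟙 (guard? π)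
      ≤⟨ ∑-mono-≤ (permutations G) (λ {π} _ → guard-on-sphere π) ⟩
    ∑[ π ∈ permutations G ] ∑[ y ∈ allFin n ] 𝟙 (inCluster?ₓ y π) * 𝟙 (onSphere? y)
      ≡⟨ ∑-swap (λ π y → 𝟙 (inCluster?ₓ y π) * 𝟙 (onSphere? y)) (permutations G) (allFin n) ⟩
    ∑[ y ∈ allFin n ] ∑[ π ∈ permutations G ] 𝟙 (inCluster?ₓ y π) * 𝟙 (onSphere? y)
      ≡⟨ ∑-cong weighted-clusterCount (allFin n) ⟩
    ∑[ y ∈ allFin n ] clusterCount y * 𝟙 (onSphere? y)
      ≤⟨ ∑-mono-≤ (allFin n) (λ {y} _ → ℕ.*-monoˡ-≤ (𝟙 (onSphere? y)) (clusterCount-≤-centre y)) ⟩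
    ∑[ y ∈ allFin n ] clusterCount x * 𝟙 (onSphere? y)
      ≡⟨ ∑-*ˡ (clusterCount x) (λ y → 𝟙 (onSphere? y)) (allFin n) ⟩
    clusterCount x * sphereSize ∎
    where
    open ℕ.≤-Reasoning
    guard? : ∀ π → Dec (IsGuard G π R x)
    guard? π = isGuard? G π R x
    guard-on-sphere : ∀ π → 𝟙 (guard? π) ≤ ∑[ y ∈ allFin n ] 𝟙 (inCluster?ₓ y π) * 𝟙 (onSphere? y)
    guard-on-sphere π = 𝟙-≤ (guard? π) λ { (y , x∈Cy , d[y,x]≡R) → begin
      1                                         ≡⟨ cong₂ _*_ (𝟙-yes (inCluster?ₓ y π) x∈Cy)
                                                             (𝟙-yes (onSphere? y) d[y,x]≡R) ⟨
      𝟙 (inCluster?ₓ y π) * 𝟙 (onSphere? y)     ≤⟨ term-≤-∑ (λ y → 𝟙 (inCluster?ₓ y π) * 𝟙 (onSphere? y))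
                                                            (∈-allFin y) ⟩
      ∑[ y ∈ allFin n ] 𝟙 (inCluster?ₓ y π) * 𝟙 (onSphere? y)  ∎ }
    weighted-clusterCount : ∀ y → ∑[ π ∈ permutations G ] 𝟙 (inCluster?ₓ y π) * 𝟙 (onSphere? y)
                                ≡ clusterCount y * 𝟙 (onSphere? y)
    weighted-clusterCount y = trans (∑-*ʳ (𝟙 (onSphere? y)) (λ π → 𝟙 (inCluster?ₓ y π)) (permutations G))
      (cong (_* 𝟙 (onSphere? y)) (sym (length-filter≡∑𝟙 (inCluster?ₓ y) (permutations G))))

  sphereSize+ballLtSize-≤ : sphereSize + ballLtSize G x R ≤ ballSize G x R
  sphereSize+ballLtSize-≤ = begin
    sphereSize + ballLtSize G x R
      ≡⟨ cong (sphereSize +_) (length-filter≡∑𝟙 inInterior? (allFin n)) ⟩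
    sphereSize + (∑[ y ∈ allFin n ] 𝟙 (inInterior? y))
      ≡⟨ ∑-+ (λ y → 𝟙 (onSphere? y)) (λ y → 𝟙 (inInterior? y)) (allFin n) ⟨
    ∑[ y ∈ allFin n ] 𝟙 (onSphere? y) + 𝟙 (inInterior? y)
      ≤⟨ ∑-mono-≤ (allFin n) (λ {y} _ → 𝟙-+-≤ (onSphere? y) (inInterior? y) (inBall? y)
           (DistLt-sym G ∘ proj₁) (DistLt-suc G) (λ d≡R d<R → proj₂ d≡R (DistLt-sym G d<R))) ⟩
    ∑[ y ∈ allFin n ] 𝟙 (inBall? y)
      ≡⟨ length-filter≡∑𝟙 inBall? (allFin n) ⟨
    ballSize G x R ∎
    where open ℕ.≤-Reasoning

  guardCount-bound : guardCount * ballSize G x R + M * ballLtSize G x R ≤ M * ballSize G x R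
  guardCount-bound = begin
    guardCount * b + M * b<                ≤⟨ ℕ.+-monoˡ-≤ (M * b<) (ℕ.*-monoˡ-≤ b guardCount-≤) ⟩
    clusterCount x * s * b + M * b<        ≡⟨ cong (_+ M * b<) (solve 3 (λ c s b → c :* s :* b := s :* (c :* b))
                                                                        refl (clusterCount x) s b) ⟩
    s * (clusterCount x * b) + M * b<      ≤⟨ ℕ.+-monoˡ-≤ (M * b<) (ℕ.*-monoʳ-≤ s clusterCount*ballSize-≤) ⟩
    s * M + M * b<                         ≡⟨ cong (_+ M * b<) (ℕ.*-comm s M) ⟩
    M * s + M * b<                         ≡⟨ ℕ.*-distribˡ-+ M s b< ⟨
    M * (s + b<)                           ≤⟨ ℕ.*-monoʳ-≤ M sphereSize+ballLtSize-≤ ⟩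
    M * b                                  ∎
    where
    open ℕ.≤-Reasoning
    open ℕ-Solver.+-*-Solver
    s = sphereSize
    b = ballSize G x R
    b< = ballLtSize G x R

guardProb≡ : ∀ {n} (G : Graph n) σ x →
  guardProb G σ x
    ≡ frac (sum (applyUpTo (λ i → guardCount G (i + σ) x) (suc σ))) (length (permutations G) * suc σ)
guardProb≡ G σ x = cong (λ c → frac c (length (permutations G) * suc σ)) (begin
  length (filter _ (cartesianProduct (permutations G) radii))
    ≡⟨ length-filter-cartesianProduct _ (permutations G) radii ⟩
  ∑[ R ∈ radii ] guardCount G R x
    ≡⟨ ∑-map (λ R → guardCount G R x) (σ +_) (upTo (suc σ)) ⟩
  ∑[ i ∈ upTo (suc σ) ] guardCount G (σ + i) x
    ≡⟨ ∑-cong (λ i → cong (λ R → guardCount G R x) (ℕ.+-comm σ i)) (upTo (suc σ)) ⟩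
  ∑[ i ∈ upTo (suc σ) ] guardCount G (i + σ) x
    ≡⟨ cong sum (List.map-applyUpTo (λ i → i) (λ i → guardCount G (i + σ) x) (suc σ)) ⟩
  sum (applyUpTo (λ i → guardCount G (i + σ) x) (suc σ)) ∎)
  where
  open ≡-Reasoning
  radii = map (σ +_) (upTo (suc σ))

lemma1p2 : ∀ {n} (G : Graph n) (σ : ℕ) → 1 ≤ σ → (x : Fin n) →
    let Δ = 4 * σ in
    (frac Δ 4 *ℚ guardProb G σ x)
      ≤ln frac (ballSize G x (Δ / 2)) (ballSize G x (Δ / 4 ∸ 1))
lemma1p2 G σ@(suc σ-1) _ x N = begin
  expPartial (frac (4 * σ) 4 *ℚ guardProb G σ x) N
    ≡⟨ cong₂ (λ p q → expPartial (p *ℚ q) N) (frac-numer-cancel 3 σ) (guardProb≡ G σ x) ⟩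
  expPartial (fromℕ σ *ℚ frac C (M * suc σ)) N
    ≤⟨ expPartial-mono-≤ N (*-nonNeg (frac-nonNeg σ 1) (frac-nonNeg C (M * suc σ))) (fromℕ*frac-≤ C M σ) ⟩
  expPartial (frac C M) N
    ≤⟨ ≤-frac _ _ (ballSize-pos G x σ-1) telescope ⟩
  frac (ballSize G x (σ + σ)) (ballSize G x σ-1)
    ≡⟨ cong₂ (λ r r′ → frac (ballSize G x r) (ballSize G x r′)) 4σ/2≡σ+σ 4σ/4∸1≡σ-1 ⟨
  frac (ballSize G x (4 * σ / 2)) (ballSize G x (4 * σ / 4 ∸ 1)) ∎
  where
  open ℚ.≤-Reasoning
  M = length (permutations G)
  C = sum (applyUpTo (λ i → guardCount G (i + σ) x) (suc σ))
  -- ballSize G x r is ballLtSize G x (suc r) by definition, and suc i + σ reduces to suc (i + σ):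
  -- this is why the radii are indexed as i + σ.
  telescope : expPartial (frac C M) N *ℚ fromℕ (ballSize G x σ-1) ≤ℚ fromℕ (ballSize G x (σ + σ))
  telescope = expPartial-telescope (permutations-nonempty G)
    (λ i → ballLtSize G x (i + σ)) (λ i → guardCount G (i + σ) x) (λ i → guardCount-bound G (i + σ) x) (suc σ) N
  4σ/2≡σ+σ : 4 * σ / 2 ≡ σ + σ
  4σ/2≡σ+σ = trans (cong (_/ 2) (solve 1 (λ σ → con 4 :* σ := (σ :+ σ) :* con 2) refl σ))
                   (ℕ.m*n/n≡m (σ + σ) 2)
    where open ℕ-Solver.+-*-Solver
  4σ/4∸1≡σ-1 : 4 * σ / 4 ∸ 1 ≡ σ-1
  4σ/4∸1≡σ-1 = cong (_∸ 1) (trans (cong (_/ 4) (ℕ.*-comm 4 σ)) (ℕ.m*n/n≡m σ 4))
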